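{- Let $d=(d_1,\ldots,d_n)$ be a sequence of positive integers, $\gamma\in[1,n]$, and $G_{d,\gamma}$ the flow network described in the context. Let $(S,T)$ be an $s$-$t$ cut of $G_{d,\gamma}$ with $S\cap X_D=\emptyset$, and let $T'=T\cup Y_S$, $S'=S\setminus Y_S$. Then $c(S',T')\le c(S,T)$.
   Context: The network $G_{d,\gamma}$ has node set $\{s,t\}\cup X\cup Y\cup X'_S\cup Y'_S$, where $X=\{x_1,\ldots,x_n\}$, $Y=\{y_1,\ldots,y_n\}$, $X_D=\{x_i:i\in[1,\gamma]\}$, $Y_D=\{y_j:j\in[1,\gamma]\}$, $X_S=\{x_i:i\in[\gamma+1,n]\}$, $Y_S=\{y_j:j\in[\gamma+1,n]\}$, $X'_S=\{x'_i:i\in[\gamma+1,n]\}$, $Y'_S=\{y'_j:j\in[\gamma+1,n]\}$. Its directed edges with capacities are: $(s,x_i)$ cap. $d_i$ and $(y_i,t)$ cap. $d_i$ for $i\in[1,n]$; $(x_i,y_j)$ cap. 1 for $i,j\in[1,\gamma]$, $i\ne j$; $(x_i,y_j)$ cap. 1 for $i\in[1,\gamma]$, $j\in[\gamma+1,n]$; $(x_i,y_j)$ cap. 1 for $i\in[\gamma+1,n]$, $j\in[1,\gamma]$; $(x_i,x'_i)$ cap. $d_i-1$ and $(y'_i,y_i)$ cap. $d_i-1$ for $i\in[\gamma+1,n]$; $(x'_i,y'_j)$ cap. 1 for $i,j\in[\gamma+1,n]$, $i\ne j$. An $s$-$t$ cut is a partition $(S,T)$ of the node set with $s\in S$, $t\in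 T$; its capacity $c(S,T)$ is the total capacity of edges directed from $S$ to $T$. $[a,b]=\{a,\ldots,b\}$. -}

module Defs where

open import Data.Nat using (ℕ; _≤_; _<_; _∸_; _≤?_; _<?_)
open import Data.Fin using (Fin; toℕ; _≟_)
open import Data.Bool using (Bool; true; false; _∧_; not; if_then_else_)
open import Data.List using (List; []; _∷_; map; concatMap; allFin; _++_)
open import Data.Nat.ListAction using (sum)
open import Data.Product using (_×_; _,_)
open import Relation.Nullary using (yes; no)
open import Relation.Nullary.Decidable using (⌊_⌋)

-- Indices are 0-based: Fin n index i stands for the paper's index i+1.
-- So x_i ∈ X_D  iff  toℕ i < γ ,  x_i ∈ X_S iff γ ≤ toℕ i.

data Node (n γ : ℕ) : Set where
  s t : Node n γ
  x y : Fin n → Node n γ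
  x' y' : (i : Fin n) → γ ≤ toℕ i → Node n γ

Edge : ℕ → ℕ → Set
Edge n γ = Node n γ × Node n γ × ℕ

module _ {n : ℕ} (γ : ℕ) (d : Fin n → ℕ) where

  private
    D : Fin n → Bool
    D i = ⌊ toℕ i <? γ ⌋

  edges : List (Edge n γ)
  edges =
       map (λ i → (s , x i , d i)) (allFin n)
    ++ map (λ i → (y i , t , d i)) (allFin n)
    ++ concatMap (λ i → concatMap (λ j →
         if (D i ∧ D j ∧ not ⌊ i ≟ j ⌋) then (x i , y j , 1) ∷ [] else
         if (D i ∧ not (D j)) then (x i , y j , 1) ∷ [] else
         if (not (D i) ∧ D j) then (x i , y j , 1) ∷ [] else [])
         (allFin n)) (allFin n)
    ++ concatMap (λ i → sx i (γ ≤? toℕ i)) (allFin n)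
    ++ concatMap (λ i → concatMap (λ j → xy' i j (γ ≤? toℕ i) (γ ≤? toℕ j) (i ≟ j))
         (allFin n)) (allFin n)
    where
    open import Relation.Nullary using (Dec)
    open import Relation.Binary.PropositionalEquality using (_≡_)
    sx : (i : Fin n) → Dec (γ ≤ toℕ i) → List (Edge n γ)
    sx i (yes p) = (x i , x' i p , d i ∸ 1) ∷ (y' i p , y i , d i ∸ 1) ∷ []
    sx i (no _)  = []
    xy' : (i j : Fin n) → Dec (γ ≤ toℕ i) → Dec (γ ≤ toℕ j) → Dec (i ≡ j) → List (Edge n γ)
    xy' i j (yes p) (yes q) (no _) = (x' i p , y' j q , 1) ∷ []
    xy' i j _ _ _ = []

  -- A cut is given by the characteristic function of its source side S
  -- (T is the complement).  Capacity = total capacity of edges from S to T.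
  capacity : (Node n γ → Bool) → ℕ
  capacity S = sum (map cost edges)
    where
    cost : Edge n γ → ℕ
    cost (u , v , c) = if (S u ∧ not (S v)) then c else 0

inYS : {n γ : ℕ} → Node n γ → Bool
inYS {γ = γ} (y j) = ⌊ γ ≤? toℕ j ⌋
inYS _ = false

moveYS : {n γ : ℕ} → (Node n γ → Bool) → (Node n γ → Bool)
moveYS S v = S v ∧ not (inYS v)

-- Moving a set M of nodes out of the source side S changes the capacity of the cut by the
-- capacity of the edges entering S ∩ M from S ∖ M minus that of the edges leaving S ∩ M for
-- the sink side.  For M = Y_S, an edge into y_j ∈ S ∩ Y_S comes either from some
-- x_i ∈ X_D, which lies outside S, or from y'_j with capacity d_j − 1; and y_j → t, of
-- capacity d_j, leaves S.  So the gain never exceeds the loss.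
module Submission where

open import Defs
open import Data.Nat using (ℕ; _≤_; _<_)
open import Data.Fin using (Fin; toℕ)
open import Data.Bool using (Bool; true; false)
open import Relation.Binary.PropositionalEquality using (_≡_)

open import Data.Bool using (_∧_; not; if_then_else_)
open import Data.Bool.Properties using (∧-zeroʳ)
open import Data.Fin using (_≟_)
open import Data.List using (List; []; _∷_; _++_; map; concatMap; allFin)
open import Data.List.Properties using (map-++; map-∘; map-cong)
open import Data.List.Relation.Unary.All using (All; []; _∷_)
open import Data.List.Relation.Unary.All.Properties using (map⁺; concat⁺; tabulate⁺)
open import Data.Nat using (_+_; _∸_; z≤n; _≤?_; _<?_)
open import Data.Nat.ListAction using (sum)
open import Data.Nat.ListAction.Properties using (sum-++)
open import Data.Nat.Properties
  using (≤-reflexive; ≤-trans; +-mono-≤; +-monoʳ-≤; +-cancelʳ-≤; +-identityʳ; m≤m+n; m≤n+m; m∸n≤m; <⇒≱;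
         +-commutativeSemigroup; module ≤-Reasoning)
open import Algebra.Properties.CommutativeSemigroup +-commutativeSemigroup using (interchange)
open import Data.Product using (_×_; _,_)
open import Function using (_∘_)
open import Relation.Binary.PropositionalEquality using (refl; sym; trans; cong; cong₂)
open import Relation.Nullary using (yes; no)
open import Relation.Nullary.Decidable using (dec-false; isYes≗does)

when : Bool → ℕ → ℕ
when b c = if b then c else 0

total : {A : Set} → (A → ℕ) → List A → ℕ
total f xs = sum (map f xs)

module _ {A : Set} where

  total-++ : (f : A → ℕ) (xs ys : List A) → total f (xs ++ ys) ≡ total f xs + total f ys
  total-++ f xs ys = trans (cong sum (map-++ f xs ys)) (sum-++ (map f xs) (map f ys))

  total-+ : (f g : A → ℕ) (xs : List A) → total (λ a → f a + g a) xs ≡ total f xs + total g xs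
  total-+ f g [] = refl
  total-+ f g (a ∷ xs) =
    trans (cong (f a + g a +_) (total-+ f g xs)) (interchange (f a) (g a) (total f xs) (total g xs))

  total-cong : {f g : A → ℕ} → (∀ a → f a ≡ g a) → (xs : List A) → total f xs ≡ total g xs
  total-cong f≗g xs = cong sum (map-cong f≗g xs)

  total-mono-≤ : {f g : A → ℕ} → (∀ a → f a ≤ g a) → (xs : List A) → total f xs ≤ total g xs
  total-mono-≤ f≤g [] = z≤n
  total-mono-≤ f≤g (a ∷ xs) = +-mono-≤ (f≤g a) (total-mono-≤ f≤g xs)

  total-≡0 : {f : A → ℕ} {xs : List A} → All (λ a → f a ≡ 0) xs → total f xs ≡ 0
  total-≡0 [] = refl
  total-≡0 (fa≡0 ∷ fxs≡0) = cong₂ _+_ fa≡0 (total-≡0 fxs≡0)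

  total-map : {B : Set} (f : A → ℕ) (h : B → A) (xs : List B) → total f (map h xs) ≡ total (f ∘ h) xs
  total-map f h xs = cong sum (sym (map-∘ xs))

  total-concatMap : {B : Set} (f : A → ℕ) (k : B → List A) (xs : List B) →
    total f (concatMap k xs) ≡ total (total f ∘ k) xs
  total-concatMap f k [] = refl
  total-concatMap f k (b ∷ xs) =
    trans (total-++ f (k b) (concatMap k xs)) (cong (total f (k b) +_) (total-concatMap f k xs))

module _ {A : Set} where

  cut : (A → Bool) → A × A × ℕ → ℕ
  cut S (u , v , c) = when (S u ∧ not (S v)) c

  _∖_ : (A → Bool) → (A → Bool) → A → Bool
  (S ∖ M) v = S v ∧ not (M v)

  entering leaving : (S M : A → Bool) → A × A × ℕ → ℕ
  entering S M (u , v , c) = when (S u ∧ not (M u) ∧ S v ∧ M v) c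
  leaving  S M (u , v , c) = when (S u ∧ M u ∧ not (S v)) c

  cut-∖ : (S M : A → Bool) (e : A × A × ℕ) →
    cut (S ∖ M) e + leaving S M e ≡ cut S e + entering S M e
  cut-∖ S M (u , v , c) with S u | M u | S v | M v
  ... | false | _     | _     | _     = refl
  ... | true  | true  | false | _     = sym (+-identityʳ c)
  ... | true  | true  | true  | _     = refl
  ... | true  | false | false | _     = refl
  ... | true  | false | true  | false = refl
  ... | true  | false | true  | true  = +-identityʳ c

  capacity-∖-≤ : (S M : A → Bool) (es : List (A × A × ℕ)) →
    total (entering S M) es ≤ total (leaving S M) es → total (cut (S ∖ M)) es ≤ total (cut S) es
  capacity-∖-≤ S M es in≤out = +-cancelʳ-≤ (total (leaving S M) es) _ _ (begin
    total (cut (S ∖ M)) es + total (leaving S M) es      ≡⟨ total-+ (cut (S ∖ M)) (leaving S M) es ⟨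
    total (λ e → cut (S ∖ M) e + leaving S M e) es       ≡⟨ total-cong (cut-∖ S M) es ⟩
    total (λ e → cut S e + entering S M e) es            ≡⟨ total-+ (cut S) (entering S M) es ⟩
    total (cut S) es + total (entering S M) es           ≤⟨ +-monoʳ-≤ (total (cut S) es) in≤out ⟩
    total (cut S) es + total (leaving S M) es            ∎)
    where open ≤-Reasoning

  module _ (S M : A → Bool) {u v : A} {c : ℕ} where

    entering-from-outside : S u ≡ false → entering S M (u , v , c) ≡ 0
    entering-from-outside u∉S rewrite u∉S = refl

    entering-unmoved : M v ≡ false → entering S M (u , v , c) ≡ 0
    entering-unmoved v∉M rewrite v∉M | ∧-zeroʳ (S v) | ∧-zeroʳ (not (M u)) | ∧-zeroʳ (S u) = refl

    entering-≤-leaving : {w : A} {c′ : ℕ} → S w ≡ false → c ≤ c′ →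
      entering S M (u , v , c) ≤ leaving S M (v , w , c′)
    entering-≤-leaving w∉S c≤c′ rewrite w∉S with S u | M u | S v | M v
    ... | false | _     | _     | _     = z≤n
    ... | true  | true  | _     | _     = z≤n
    ... | true  | false | false | _     = z≤n
    ... | true  | false | true  | false = z≤n
    ... | true  | false | true  | true  = c≤c′

module Network {n : ℕ} (γ : ℕ) (d : Fin n → ℕ) where

  sourceEdges sinkEdges : List (Edge n γ)
  sourceEdges = map (λ i → s , x i , d i) (allFin n)
  sinkEdges   = map (λ i → y i , t , d i) (allFin n)

  pairs : (Fin n → Fin n → List (Edge n γ)) → List (Edge n γ)
  pairs f = concatMap (λ i → concatMap (f i) (allFin n)) (allFin n)

  pairs⁺ : {P : Edge n γ → Set} {f : Fin n → Fin n → List (Edge n γ)} →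
    (∀ i j → All P (f i j)) → All P (pairs f)
  pairs⁺ Pf = concat⁺ (map⁺ (tabulate⁺ λ i → concat⁺ (map⁺ (tabulate⁺ (Pf i)))))

  -- Two of these families live in the private where-block of `edges` and cannot be named;
  -- checking `refl` against this record type recovers all three by unification.
  record Layout : Set where
    field
      xy    : Fin n → Fin n → List (Edge n γ)
      split : Fin n → List (Edge n γ)
      x'y'  : Fin n → Fin n → List (Edge n γ)
      edges-layout : edges γ d ≡
        sourceEdges ++ sinkEdges ++ pairs xy ++ concatMap split (allFin n) ++ pairs x'y'

  layout : Layout
  layout = record { edges-layout = refl }

  open Layout layout

  splitEdges : List (Edge n γ)
  splitEdges = concatMap split (allFin n)

  total-edges : (f : Edge n γ → ℕ) → total f (edges γ d) ≡
    total f sourceEdges + (total f sinkEdges + (total f (pairs xy) + (total f splitEdges + total f (pairs x'y'))))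
  total-edges f rewrite edges-layout
                      | total-++ f sourceEdges (sinkEdges ++ pairs xy ++ splitEdges ++ pairs x'y')
                      | total-++ f sinkEdges (pairs xy ++ splitEdges ++ pairs x'y')
                      | total-++ f (pairs xy) (splitEdges ++ pairs x'y')
                      | total-++ f splitEdges (pairs x'y') = refl

  total-split-≤ : (f : Edge n γ → ℕ) (i : Fin n) {r : ℕ} →
    (∀ p → f (x i , x' i p , d i ∸ 1) ≡ 0) → (∀ p → f (y' i p , y i , d i ∸ 1) ≤ r) → total f (split i) ≤ r
  total-split-≤ f i xx'≡0 y'y≤r with γ ≤? toℕ i
  ... | no _  = z≤n
  ... | yes p rewrite xx'≡0 p | +-identityʳ (f (y' i p , y i , d i ∸ 1)) = y'y≤r p

  y∉YS : {j : Fin n} → toℕ j < γ → inYS (y j) ≡ false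
  y∉YS {j} j<γ = trans (isYes≗does (γ ≤? toℕ j)) (dec-false (γ ≤? toℕ j) (<⇒≱ j<γ))

  total-sinkEdges-≤ : (f : Edge n γ → ℕ) → total f sinkEdges ≤ total f (edges γ d)
  total-sinkEdges-≤ f = ≤-trans (≤-trans (m≤m+n (total f sinkEdges) _) (m≤n+m _ (total f sourceEdges)))
                                 (≤-reflexive (sym (total-edges f)))

  module _ (S : Node n γ → Bool) (S-t : S t ≡ false)
           (X_D∩S=∅ : ∀ i → toℕ i < γ → S (x i) ≡ false) where

    sourceEdges-entering≡0 : All (λ e → entering S inYS e ≡ 0) sourceEdges
    sourceEdges-entering≡0 = map⁺ (tabulate⁺ λ _ → entering-unmoved S inYS refl)

    sinkEdges-entering≡0 : All (λ e → entering S inYS e ≡ 0) sinkEdges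
    sinkEdges-entering≡0 = map⁺ (tabulate⁺ λ _ → entering-unmoved S inYS refl)

    xy-entering≡0 : ∀ i j → All (λ e → entering S inYS e ≡ 0) (xy i j)
    xy-entering≡0 i j with toℕ i <? γ | toℕ j <? γ | i ≟ j
    ... | yes _   | yes _   | yes _ = []
    ... | yes i<γ | yes _   | no _  = entering-from-outside S inYS (X_D∩S=∅ i i<γ) ∷ []
    ... | yes i<γ | no _    | _     = entering-from-outside S inYS (X_D∩S=∅ i i<γ) ∷ []
    ... | no _    | yes j<γ | _     = entering-unmoved S inYS (y∉YS j<γ) ∷ []
    ... | no _    | no _    | _     = []

    x'y'-entering≡0 : ∀ i j → All (λ e → entering S inYS e ≡ 0) (x'y' i j)
    x'y'-entering≡0 i j with γ ≤? toℕ i | γ ≤? toℕ j | i ≟ j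
    ... | yes _ | yes _ | no _  = entering-unmoved S inYS refl ∷ []
    ... | yes _ | yes _ | yes _ = []
    ... | yes _ | no _  | _     = []
    ... | no _  | _     | _     = []

    total-entering-edges : total (entering S inYS) (edges γ d) ≡ total (entering S inYS) splitEdges
    total-entering-edges
      rewrite total-edges (entering S inYS)
            | total-≡0 sourceEdges-entering≡0 | total-≡0 sinkEdges-entering≡0
            | total-≡0 (pairs⁺ xy-entering≡0) | total-≡0 (pairs⁺ x'y'-entering≡0)
      = +-identityʳ _

    entering-split≤leaving-sink : total (entering S inYS) splitEdges ≤ total (leaving S inYS) sinkEdges
    entering-split≤leaving-sink = begin
      total (entering S inYS) (concatMap split (allFin n))
        ≡⟨ total-concatMap (entering S inYS) split (allFin n) ⟩
      total (total (entering S inYS) ∘ split) (allFin n)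
        ≤⟨ total-mono-≤ (λ i → total-split-≤ (entering S inYS) i
             (λ _ → entering-unmoved S inYS refl) (λ _ → entering-≤-leaving S inYS S-t (m∸n≤m (d i) 1))) (allFin n) ⟩
      total (leaving S inYS ∘ λ i → y i , t , d i) (allFin n)
        ≡⟨ total-map (leaving S inYS) (λ i → y i , t , d i) (allFin n) ⟨
      total (leaving S inYS) sinkEdges
        ∎
      where open ≤-Reasoning

    entering≤leaving : total (entering S inYS) (edges γ d) ≤ total (leaving S inYS) (edges γ d)
    entering≤leaving = begin
      total (entering S inYS) (edges γ d)  ≡⟨ total-entering-edges ⟩
      total (entering S inYS) splitEdges   ≤⟨ entering-split≤leaving-sink ⟩
      total (leaving S inYS) sinkEdges     ≤⟨ total-sinkEdges-≤ (leaving S inYS) ⟩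
      total (leaving S inYS) (edges γ d)   ∎
      where open ≤-Reasoning

lemma7 : (n : ℕ) (d : Fin n → ℕ) → (∀ i → 1 ≤ d i) →
    (γ : ℕ) → 1 ≤ γ → γ ≤ n →
    (S : Node n γ → Bool) → S s ≡ true → S t ≡ false →
    (∀ i → toℕ i < γ → S (x i) ≡ false) →
    capacity γ d (moveYS S) ≤ capacity γ d S
-- `capacity γ d R` unfolds to `total (cut R) (edges γ d)` and `moveYS S` to `S ∖ inYS`.
lemma7 n d _ γ _ _ S _ S-t X_D∩S=∅ =
  capacity-∖-≤ S inYS (edges γ d) (Network.entering≤leaving γ d S S-t X_D∩S=∅)
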